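{- Let $\Gamma$ be a 2-colored best match graph (2-cBMG). Every $\dot{\sim}$-consistent underlying oriented digraph of $\Gamma$ is acyclic. If $\Gamma$ contains no two (distinct) equivalent vertices, then the only directed cycles of $\Gamma$ have length $2$ and are induced by symmetric edges.
   Context: Digraphs have no loops or multiple edges; $N(x)$, $N^-(x)$ are out- and in-neighbourhoods, $N(S)=\bigcup_{s\in S}N(s)$. A 2-cBMG is a bipartite digraph (two colour classes, every edge joining different classes), not necessarily connected, satisfying: N1: for any two vertices $x,y$ with $x\notin N(y)$, $y\notin N(x)$, $N(x)\cap N(N(y))=N(y)\cap N(N(x))=\emptyset$; N2: $N(N(N(x)))\subseteq N(x)$ for all $x$ (bi-transitivity); N3: for any vertices $x,y$ with $x\notin N(N(y))$, $y\notin N(N(x))$ and $N(x)\cap N(y)\neq\emptyset$, $N^-(x)=N^-(y)$ and $N(x)\subseteq N(y)$ or $N(y)\subseteq N(x)$; N4: every vertex has an out-neighbour. Vertices $x,y$ are equivalent ($x\dot{\sim}y$) if $N(x)=N(y)$ and $N^-(x)=N^-(y)$. A symmetric edge is a pair with both $xy,yx$ edges. An underlying oriented digraph is obtained by deleting exactly one of $xy,yx$ from each symmetric edge; it is $\dot{\sim}$-consistent if for $u\dot{\sim}u'$, $v\dot{\sim}v'$, $uv$ is kept iff $u'v'$ is kept. A directed cycle is a closed directed trail with all vertices except first and last distinct; acyclic means no directed cycle. -}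

module Defs where

open import Data.Nat using (ℕ; suc)
open import Data.Fin using (Fin; zero; suc; inject₁; fromℕ)
open import Data.Bool using (Bool; T)
open import Data.Product using (Σ; ∃; _×_; _,_)
open import Data.Sum using (_⊎_)
open import Relation.Nullary using (¬_)
open import Relation.Binary.PropositionalEquality using (_≡_; _≢_)
open import Function.Definitions using (Injective)

-- A finite digraph on vertex set Fin n, given by a Boolean adjacency matrix.
-- Edge G x y  means  xy is an edge, i.e. y ∈ N(x).
Digraph : ℕ → Set
Digraph n = Fin n → Fin n → Bool

module _ {n : ℕ} (G : Digraph n) where

  Edge : Fin n → Fin n → Set
  Edge x y = T (G x y)

  Loopless : Set
  Loopless = ∀ x → ¬ Edge x x

  ProperColouring : (Fin n → Bool) → Set
  ProperColouring col = ∀ x y → Edge x y → col x ≢ col y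

  InNN : Fin n → Fin n → Set
  InNN y z = ∃ λ w → Edge y w × Edge w z

  N1 : Set
  N1 = ∀ x y → ¬ Edge y x → ¬ Edge x y →
         (∀ z → Edge x z → ¬ InNN y z) × (∀ z → Edge y z → ¬ InNN x z)

  N2 : Set
  N2 = ∀ x a b c → Edge x a → Edge a b → Edge b c → Edge x c

  N3 : Set
  N3 = ∀ x y → ¬ InNN y x → ¬ InNN x y → (∃ λ z → Edge x z × Edge y z) →
         ((∀ w → (Edge w x → Edge w y) × (Edge w y → Edge w x))
          × ((∀ z → Edge x z → Edge y z) ⊎ (∀ z → Edge y z → Edge x z)))

  N4 : Set
  N4 = ∀ x → ∃ λ y → Edge x y

  -- 2-coloured best match graph (not necessarily connected)
  Is2cBMG : Set
  Is2cBMG = Loopless × (Σ (Fin n → Bool) ProperColouring) × N1 × N2 × N3 × N4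

  Equiv : Fin n → Fin n → Set
  Equiv x y = (∀ z → (Edge x z → Edge y z) × (Edge y z → Edge x z))
            × (∀ z → (Edge z x → Edge z y) × (Edge z y → Edge z x))

  IsUnderlyingOriented : Digraph n → Set
  IsUnderlyingOriented O =
      (∀ x y → T (O x y) → Edge x y)
    × (∀ x y → Edge x y → ¬ Edge y x → T (O x y))
    × (∀ x y → Edge x y → Edge y x → (T (O x y) ⊎ T (O y x)) × ¬ (T (O x y) × T (O y x)))

  ≐-Consistent : Digraph n → Set
  ≐-Consistent O = ∀ u u' v v' → Equiv u u' → Equiv v v' →
                     (T (O u v) → T (O u' v')) × (T (O u' v') → T (O u v))

-- A directed cycle of length (suc k) in G: distinct vertices
-- c 0, c 1, …, c k with edges c i → c (i+1) and c k → c 0.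
record DirCycle {n : ℕ} (G : Digraph n) (k : ℕ) : Set where
  field
    vtx      : Fin (suc k) → Fin n
    distinct : Injective _≡_ _≡_ vtx
    step     : ∀ (i : Fin k) → Edge G (vtx (inject₁ i)) (vtx (suc i))
    close    : Edge G (vtx (fromℕ k)) (vtx zero)

Acyclic : {n : ℕ} → Digraph n → Set
Acyclic G = ∀ k → ¬ DirCycle G k

-- By bi-transitivity (N2) every walk collapses to a walk of length at most 2.
-- On a directed cycle x₀ → x₁ → x₂ → ⋯ → x₀ of length at least 3 the walk from
-- x₂ back to x₀ therefore becomes an edge (impossible: x₀x₁x₂x₀ would give a
-- loop) or a 2-path x₂ → c → x₀, and N2 then forces x₂x₁ and x₀ ≐ x₂.  So a
-- long cycle contains the symmetric edge x₁x₂ together with the edge x₀x₁ from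
-- a vertex equivalent to x₂: a ≐-consistent orientation must keep both x₁x₂ and
-- x₂x₁, and without distinct equivalent vertices x₀ = x₂ contradicts
-- distinctness.
module Submission where

open import Defs
open import Data.Nat using (ℕ; zero; suc)
open import Data.Fin using (Fin; zero; suc; inject₁; fromℕ)
open import Data.Bool using (T)
open import Data.Product using (_×_; _,_; proj₁; proj₂)
open import Data.Sum using (_⊎_; inj₁; inj₂)
open import Data.Empty using (⊥-elim)
open import Relation.Binary.PropositionalEquality using (_≡_; _≢_; refl)

module _ {n : ℕ} (G : Digraph n) where

  data Walk : Fin n → Fin n → Set where
    []  : ∀ {a} → Walk a a
    _∷_ : ∀ {a b c} → Edge G a b → Walk b c → Walk a c

  Equiv-refl : ∀ x → Equiv G x x
  Equiv-refl x = (λ _ → (λ e → e) , (λ e → e)) , (λ _ → (λ e → e) , (λ e → e))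

module _ {n : ℕ} {G : Digraph n} where

  _∷ʳ_ : ∀ {a b c} → Walk G a b → Edge G b c → Walk G a c
  [] ∷ʳ e = e ∷ []
  (e′ ∷ w) ∷ʳ e = e′ ∷ (w ∷ʳ e)

  walk-along : ∀ k (f : Fin (suc k) → Fin n) →
    (∀ (i : Fin k) → Edge G (f (inject₁ i)) (f (suc i))) →
    Walk G (f zero) (f (fromℕ k))
  walk-along zero    f step = []
  walk-along (suc k) f step = step zero ∷ walk-along k (λ i → f (suc i)) (λ i → step (suc i))

  walk-x₂-to-x₀ : ∀ {k} (C : DirCycle G (suc (suc k))) →
    Walk G (DirCycle.vtx C (suc (suc zero))) (DirCycle.vtx C zero)
  walk-x₂-to-x₀ {k} C =
    walk-along k (λ i → vtx (suc (suc i))) (λ i → step (suc (suc i))) ∷ʳ close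
    where open DirCycle C

module _ {n : ℕ} {G : Digraph n} (bitrans : N2 G) where

  walk-shortcut : ∀ {a b} → Walk G a b → a ≡ b ⊎ Edge G a b ⊎ InNN G a b
  walk-shortcut [] = inj₁ refl
  walk-shortcut (e ∷ w) with walk-shortcut w
  ... | inj₁ refl                 = inj₂ (inj₁ e)
  ... | inj₂ (inj₁ e′)            = inj₂ (inj₂ (_ , e , e′))
  ... | inj₂ (inj₂ (_ , e′ , e″)) = inj₂ (inj₁ (bitrans _ _ _ _ e e′ e″))

  square-equiv : ∀ {x₀ x₁ x₂} → Edge G x₀ x₁ → Edge G x₁ x₂ → InNN G x₂ x₀ →
    Equiv G x₀ x₂ × Edge G x₂ x₁
  square-equiv {x₀} {x₁} {x₂} e₀₁ e₁₂ (_ , e₂c , ec₀) =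
      ((λ _ → (λ e → bitrans _ _ _ _ e₂₁ e₁₀ e) , (λ e → bitrans _ _ _ _ e₀₁ e₁₂ e))
      , (λ _ → (λ e → bitrans _ _ _ _ e e₀₁ e₁₂) , (λ e → bitrans _ _ _ _ e e₂₁ e₁₀)))
    , e₂₁
    where
    e₂₁ : Edge G x₂ x₁
    e₂₁ = bitrans _ _ _ _ e₂c ec₀ e₀₁
    e₁₀ : Edge G x₁ x₀
    e₁₀ = bitrans _ _ _ _ e₁₂ e₂c ec₀

  long-cycle-equiv : Loopless G → ∀ {k} (C : DirCycle G (suc (suc k))) →
    let open DirCycle C in
    Equiv G (vtx zero) (vtx (suc (suc zero))) × Edge G (vtx (suc (suc zero))) (vtx (suc zero))
  long-cycle-equiv loopless C with walk-shortcut (walk-x₂-to-x₀ C)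
  ... | inj₁ x₂≡x₀ with DirCycle.distinct C x₂≡x₀
  ...   | ()
  long-cycle-equiv loopless C | inj₂ (inj₁ e₂₀) =
    ⊥-elim (loopless _ (bitrans _ _ _ _ (DirCycle.step C zero) (DirCycle.step C (suc zero)) e₂₀))
  long-cycle-equiv loopless C | inj₂ (inj₂ p₂₀) =
    square-equiv (DirCycle.step C zero) (DirCycle.step C (suc zero)) p₂₀

DirCycle-map : ∀ {n} {G H : Digraph n} → (∀ x y → T (G x y) → Edge H x y) →
  ∀ {k} → DirCycle G k → DirCycle H k
DirCycle-map G⊆H C = record
  { vtx = vtx ; distinct = distinct ; step = λ i → G⊆H _ _ (step i) ; close = G⊆H _ _ close }
  where open DirCycle C

module _ {n : ℕ} {G : Digraph n} (loopless : Loopless G) (bitrans : N2 G) where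

  consistent-orientation-acyclic : ∀ O → IsUnderlyingOriented G O → ≐-Consistent G O → Acyclic O
  consistent-orientation-acyclic O (O⊆G , _ , _) _ zero C =
    loopless _ (O⊆G _ _ (DirCycle.close C))
  consistent-orientation-acyclic O (O⊆G , _ , one-of) _ (suc zero) C =
    proj₂ (one-of _ _ (O⊆G _ _ (step zero)) (O⊆G _ _ close)) (step zero , close)
    where open DirCycle C
  consistent-orientation-acyclic O (O⊆G , _ , one-of) consistent (suc (suc k)) C
    with long-cycle-equiv bitrans loopless (DirCycle-map O⊆G C)
  ... | x₀≐x₂ , e₂₁ =
    proj₂ (one-of _ _ e₂₁ (O⊆G _ _ (step (suc zero)))) (o₂₁ , step (suc zero))
    where
    open DirCycle C
    o₂₁ : T (O (vtx (suc (suc zero))) (vtx (suc zero)))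
    o₂₁ = proj₁ (consistent _ _ _ _ x₀≐x₂ (Equiv-refl G _)) (step zero)

  cycles-are-symmetric-edges : (∀ x y → Equiv G x y → x ≡ y) →
    ∀ k (C : DirCycle G k) → (k ≡ 1)
      × (∀ i j → i ≢ j → Edge G (DirCycle.vtx C i) (DirCycle.vtx C j))
  cycles-are-symmetric-edges _ zero C = ⊥-elim (loopless _ (DirCycle.close C))
  cycles-are-symmetric-edges _ (suc zero) C = refl , edge
    where
    open DirCycle C
    edge : ∀ i j → i ≢ j → Edge G (vtx i) (vtx j)
    edge zero       zero       i≢j = ⊥-elim (i≢j refl)
    edge zero       (suc zero) _   = step zero
    edge (suc zero) zero       _   = close
    edge (suc zero) (suc zero) i≢j = ⊥-elim (i≢j refl)
  cycles-are-symmetric-edges twin-free (suc (suc k)) C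
    with DirCycle.distinct C (twin-free _ _ (proj₁ (long-cycle-equiv bitrans loopless C)))
  ... | ()

corollary2 : ∀ (n : ℕ) (G : Digraph n) → Is2cBMG G →
    (∀ (O : Digraph n) → IsUnderlyingOriented G O → ≐-Consistent G O → Acyclic O)
    × ((∀ x y → Equiv G x y → x ≡ y) →
       ∀ k (C : DirCycle G k) → (k ≡ 1)
         × (∀ i j → i ≢ j → Edge G (DirCycle.vtx C i) (DirCycle.vtx C j)))
corollary2 n G (loopless , _ , _ , bitrans , _) =
  consistent-orientation-acyclic loopless bitrans , cycles-are-symmetric-edges loopless bitrans
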